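{- A positive integer $n$ satisfies $\delta(n)<1$ if and only if it can be written in one of the following forms (with all parameters nonnegative integers), and in each case it has the indicated complexity: (1) $3^k$ with $k\ge 1$, of complexity $3k$; (2) $2^a3^k$ with $a\le 9$, $a,k$ not both zero, of complexity $2a+3k$; (3) $5\cdot 2^a3^k$ with $a\le 3$, of complexity $5+2a+3k$; (4) $7\cdot 2^a 3^k$ with $a\le 2$, of complexity $6+2a+3k$; (5) $19\cdot 3^k$, of complexity $9+3k$; (6) $13\cdot 3^k$, of complexity $8+3k$; (7) $(3^m+1)3^k$ with $m\ne 0$, of complexity $1+3m+3k$. Furthermore, $n=1$ is the only positive integer with $\delta(n)=1$.
   Context: For a positive integer $n$, its complexity $\|n\|$ is the least number of $1$'s needed to write $n$ using only the constant $1$, addition, multiplication, and parentheses (so $\|1\|=1$ and for $n>1$, $\|n\|=\min\{\|a\|+\|b\|: a,b<n,\ a+b=n \text{ or } ab=n\}$). The defect of $n$ is $\delta(n)=\|n\|-3\log_3 n$. -}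

module Defs where

open import Data.Nat using (ℕ; zero; suc; _+_; _*_; _∸_; _^_; _≤_; _<_)
open import Data.Product using (Σ; _×_; _,_)
open import Relation.Binary.PropositionalEquality using (_≡_)
open import Relation.Nullary using (¬_)

data Expr : Set where
  one  : Expr
  _⊕_  : Expr → Expr → Expr
  _⊗_  : Expr → Expr → Expr

eval : Expr → ℕ
eval one       = 1
eval (e ⊕ f)   = eval e + eval f
eval (e ⊗ f)   = eval e * eval f

ones : Expr → ℕ
ones one     = 1
ones (e ⊕ f) = ones e + ones f
ones (e ⊗ f) = ones e + ones f

IsComplexity : ℕ → ℕ → Set
IsComplexity n c =
  Σ Expr (λ e → eval e ≡ n × ones e ≡ c) × (∀ e → eval e ≡ n → c ≤ ones e)

-- δ(n) = ‖n‖ - 3 log₃ n.  With c = ‖n‖ ≥ 1: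
--   δ(n) < 1  ⟺  c - 1 < 3 log₃ n  ⟺  3^(c-1) < n^3
--   δ(n) = 1  ⟺  3^(c-1) = n^3
DefectLt1 : ℕ → ℕ → Set
DefectLt1 n c = 3 ^ (c ∸ 1) < n ^ 3

DefectEq1 : ℕ → ℕ → Set
DefectEq1 n c = 3 ^ (c ∸ 1) ≡ n ^ 3

data LowForm (n : ℕ) : Set where
  form1 : (k : ℕ) → 1 ≤ k → n ≡ 3 ^ k → LowForm n
  form2 : (a k : ℕ) → a ≤ 9 → ¬ (a ≡ 0 × k ≡ 0) → n ≡ 2 ^ a * 3 ^ k → LowForm n
  form3 : (a k : ℕ) → a ≤ 3 → n ≡ 5 * 2 ^ a * 3 ^ k → LowForm n
  form4 : (a k : ℕ) → a ≤ 2 → n ≡ 7 * 2 ^ a * 3 ^ k → LowForm n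
  form5 : (k : ℕ) → n ≡ 19 * 3 ^ k → LowForm n
  form6 : (k : ℕ) → n ≡ 13 * 3 ^ k → LowForm n
  form7 : (m k : ℕ) → 1 ≤ m → n ≡ (3 ^ m + 1) * 3 ^ k → LowForm n

-- Induction on expressions gives n³ ≤ 3^‖n‖, i.e. δ(n) ≥ 0.  Now let e be an optimal expression
-- for n with δ(n) < 1.  If e = e₁ ⊗ e₂, the defects of the factors add up to δ(n), so both
-- factors have defect < 1.  If e = e₁ ⊕ e₂ with n > 7, one summand is 1 (for a, b ≥ 2 with
-- a + b ≥ 8 already 3(a+b)³ ≤ (ab)³, which forces δ ≥ 1), and then the other summand has
-- defect < 1 as well.  Hence, by induction, n = v·3^k for a core v among 3, 2^a (1 ≤ a ≤ 9),
-- 5·2^a (a ≤ 3), 7·2^a (a ≤ 2), 19, 13 and 3^m + 1, with ‖n‖ = ‖v‖ + 3k: the cores are closed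
-- under low-defect products and successors.  For the finite cores and small k this is settled
-- by evaluation; larger members of the infinite families reduce to those, because multiplying a
-- number by at most 3^d while adding 3d to its cost keeps the defect ≥ 1.  Conversely an
-- expression of defect < 1 is automatically optimal, which gives the complexities of the seven
-- forms.  Finally, δ(n) = 1 means n³ = 3^(‖n‖-1), so n is a power of 3, and only n = 1 fits.

module Submission where

open import Defs
open import Data.Empty using (⊥-elim)
open import Data.Fin using (Fin; toℕ; fromℕ<; #_)
open import Data.Fin.Properties using (all?; any?; toℕ<n; toℕ-fromℕ<)
open import Data.Nat
  using (ℕ; zero; suc; _+_; _*_; _^_; _∸_; _≤_; _<_; z≤n; s≤s; s≤s⁻¹; _≟_; _≤?_; _<?_; >-nonZero)
open import Data.Nat.Divisibility using (_∣_; divides; ∣1⇒≡1)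
open import Data.Nat.Primality using (Prime; prime?; euclidsLemma; ¬prime[1])
open import Data.Nat.Properties
open import Data.Nat.Solver using (module +-*-Solver)
open import Data.Product using (_×_; _,_; Σ; ∃-syntax)
import Data.Product as Product
open import Data.Sum using (_⊎_; inj₁; inj₂)
open import Function using (_∘_)
open import Function.Bundles using (_⇔_; mk⇔; Equivalence)
open import Relation.Binary.PropositionalEquality
open import Relation.Nullary using (¬_; Dec; yes; no)
open import Relation.Nullary.Decidable using (map′; from-yes; from-no; ¬?; _⊎-dec_; _×-dec_)
open import Relation.Unary using (Decidable)

open +-*-Solver

-- For c ≥ 1 this says c - 1 < 3 log₃ n.  It is a record so that unification compares its
-- arguments instead of unfolding them into large arithmetic terms.
record LowCost (n c : ℕ) : Set where
  constructor lowCost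
  field
    3^c<3n³ : 3 ^ c < 3 * n ^ 3

lowCost? : ∀ n c → Dec (LowCost n c)
lowCost? n c = map′ lowCost LowCost.3^c<3n³ (3 ^ c <? 3 * n ^ 3)

lowCost⇔defectLt1 : ∀ {n c} → 1 ≤ c → LowCost n c ⇔ DefectLt1 n c
lowCost⇔defectLt1 {n} {suc c} _ =
  mk⇔ (λ (lowCost p) → *-cancelˡ-< 3 (3 ^ c) (n ^ 3) p) (λ p → lowCost (*-monoʳ-< 3 p))

lowCost-mono : ∀ {n n′ c} → LowCost n c → n ≤ n′ → LowCost n′ c
lowCost-mono (lowCost p) n≤n′ = lowCost (<-≤-trans p (*-monoʳ-≤ 3 (^-monoˡ-≤ 3 n≤n′)))

lowCost-antimono : ∀ {n c c′} → LowCost n c → c′ ≤ c → LowCost n c′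
lowCost-antimono (lowCost p) c′≤c = lowCost (≤-<-trans (^-monoʳ-≤ 3 c′≤c) p)

lowCost-*-comm : ∀ a b x y → LowCost (a * b) (x + y) → LowCost (b * a) (y + x)
lowCost-*-comm a b x y = subst₂ LowCost (*-comm a b) (+-comm x y)

cube-3^ : ∀ k → (3 ^ k) ^ 3 ≡ 3 ^ (3 * k)
cube-3^ k = trans (^-*-assoc 3 k 3) (cong (3 ^_) (*-comm k 3))

3[n*3^k]³ : ∀ n k → 3 * (n * 3 ^ k) ^ 3 ≡ 3 * n ^ 3 * 3 ^ (3 * k)
3[n*3^k]³ n k = begin
  3 * (n * 3 ^ k) ^ 3
    ≡⟨ solve 2 (λ n t → con 3 :* (n :* t) :^ 3 := con 3 :* n :^ 3 :* t :^ 3) refl n (3 ^ k) ⟩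
  3 * n ^ 3 * (3 ^ k) ^ 3   ≡⟨ cong (3 * n ^ 3 *_) (cube-3^ k) ⟩
  3 * n ^ 3 * 3 ^ (3 * k)   ∎
  where open ≡-Reasoning

lowCost-*3^ : ∀ {n c} k → LowCost n c → LowCost (n * 3 ^ k) (c + 3 * k)
lowCost-*3^ {n} {c} k (lowCost p) = lowCost (subst₂ _<_ (sym (^-distribˡ-+-* 3 c (3 * k))) (sym (3[n*3^k]³ n k))
  (*-monoˡ-< (3 ^ (3 * k)) {{m^n≢0 3 (3 * k)}} p))

lowCost-/3^ : ∀ {n c} k → LowCost (n * 3 ^ k) (c + 3 * k) → LowCost n c
lowCost-/3^ {n} {c} k (lowCost p) = lowCost (*-cancelʳ-< (3 ^ (3 * k)) (3 ^ c) (3 * n ^ 3)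
  (subst₂ _<_ (^-distribˡ-+-* 3 c (3 * k)) (3[n*3^k]³ n k) p))

lowCost-≤*3^ : ∀ {n} m c d → n ≤ m * 3 ^ d → LowCost n (c + 3 * d) → LowCost m c
lowCost-≤*3^ m c d n≤ low = lowCost-/3^ {m} {c} d (lowCost-mono {c = c + 3 * d} low n≤)

lowCost-*ˡ : ∀ {a b x y} → LowCost (a * b) (x + y) → b ^ 3 ≤ 3 ^ y → LowCost a x
lowCost-*ˡ {a} {b} {x} {y} (lowCost p) b³≤ = lowCost (≰⇒> λ 3a³≤ → <⇒≱ p (begin
  3 * (a * b) ^ 3     ≡⟨ solve 2 (λ a b → con 3 :* (a :* b) :^ 3 := con 3 :* a :^ 3 :* b :^ 3) refl a b ⟩
  3 * a ^ 3 * b ^ 3   ≤⟨ *-mono-≤ 3a³≤ b³≤ ⟩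
  3 ^ x * 3 ^ y       ≡⟨ ^-distribˡ-+-* 3 x y ⟨
  3 ^ (x + y)         ∎))
  where open ≤-Reasoning

[1+a]³≤3a³ : ∀ {a} → 3 ≤ a → suc a ^ 3 ≤ 3 * a ^ 3
[1+a]³≤3a³ {suc (suc (suc s))} (s≤s (s≤s (s≤s _))) = ≤-trans (m≤m+n _ (17 + 33 * s + 15 * s ^ 2 + 2 * s ^ 3))
  (≤-reflexive (solve 1 (λ s → (con 4 :+ s) :^ 3 :+ (con 17 :+ con 33 :* s :+ con 15 :* s :^ 2 :+ con 2 :* s :^ 3)
                              := con 3 :* (con 3 :+ s) :^ 3) refl s))

lowCost-suc⁻¹ : ∀ {a x} → 3 ≤ a → LowCost (suc a) (suc x) → LowCost a x
lowCost-suc⁻¹ {a} {x} 3≤a (lowCost p) =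
  lowCost (*-cancelˡ-< 3 (3 ^ x) (3 * a ^ 3) (<-≤-trans p (*-monoʳ-≤ 3 ([1+a]³≤3a³ 3≤a))))

m+n≤m*n : ∀ {m n} → 2 ≤ m → 2 ≤ n → m + n ≤ m * n
m+n≤m*n {suc (suc s)} {suc (suc t)} (s≤s (s≤s _)) (s≤s (s≤s _)) = ≤-trans (m≤m+n _ (s + t + s * t))
  (≤-reflexive (solve 2 (λ s t → con 2 :+ s :+ (con 2 :+ t) :+ (s :+ t :+ s :* t)
                              := (con 2 :+ s) :* (con 2 :+ t)) refl s t))

m*o+n≤[m+n]*o : ∀ m n {o} → 1 ≤ o → m * o + n ≤ (m + n) * o
m*o+n≤[m+n]*o m n {o} 1≤o = begin
  m * o + n       ≤⟨ +-monoʳ-≤ (m * o) (m≤m*n n o {{>-nonZero 1≤o}}) ⟩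
  m * o + n * o   ≡⟨ *-distribʳ-+ o m n ⟨
  (m + n) * o     ∎
  where open ≤-Reasoning

cube-suc-≤ : ∀ a {x} → 1 ≤ x → a ^ 3 ≤ 3 ^ x → suc a ^ 3 ≤ 3 ^ suc x
cube-suc-≤ 0 {x} _ _ = ^-monoʳ-≤ 3 {0} {suc x} z≤n
cube-suc-≤ 1 {x} 1≤x _ = ≤-trans (n≤1+n 8) (^-monoʳ-≤ 3 {2} {suc x} (s≤s 1≤x))
cube-suc-≤ 2 {x} _ 8≤3^x = ^-monoʳ-≤ 3 {3} {suc x} (s≤s (2≤x x 8≤3^x))
  where
  2≤x : ∀ x → 8 ≤ 3 ^ x → 2 ≤ x
  2≤x (suc (suc _)) _ = s≤s (s≤s z≤n)
  2≤x 0 (s≤s ())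
  2≤x 1 (s≤s (s≤s (s≤s ())))
cube-suc-≤ a@(suc (suc (suc _))) _ a³≤ =
  ≤-trans ([1+a]³≤3a³ {a} (s≤s (s≤s (s≤s z≤n)))) (*-monoʳ-≤ 3 a³≤)

cube-+-≤ : ∀ a b {x y} → 1 ≤ x → 1 ≤ y → a ^ 3 ≤ 3 ^ x → b ^ 3 ≤ 3 ^ y → (a + b) ^ 3 ≤ 3 ^ (x + y)
cube-+-≤ 0 _ {x} {y} _ _ _ b³≤ = ≤-trans b³≤ (^-monoʳ-≤ 3 (m≤n+m y x))
cube-+-≤ 1 b {x} {y} 1≤x 1≤y _ b³≤ = ≤-trans (cube-suc-≤ b 1≤y b³≤) (^-monoʳ-≤ 3 (+-monoˡ-≤ y 1≤x))
cube-+-≤ a 0 {x} {y} _ _ a³≤ _ =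
  subst (λ z → z ^ 3 ≤ 3 ^ (x + y)) (sym (+-identityʳ a)) (≤-trans a³≤ (^-monoʳ-≤ 3 (m≤m+n x y)))
cube-+-≤ a 1 {x} {y} 1≤x 1≤y a³≤ _ =
  subst (λ z → z ^ 3 ≤ 3 ^ (x + y)) (+-comm 1 a)
    (≤-trans (cube-suc-≤ a 1≤x a³≤) (^-monoʳ-≤ 3 (subst (_≤ x + y) (+-comm x 1) (+-monoʳ-≤ x 1≤y))))
cube-+-≤ a@(suc (suc _)) b@(suc (suc _)) {x} {y} _ _ a³≤ b³≤ = begin
  (a + b) ^ 3     ≤⟨ ^-monoˡ-≤ 3 (m+n≤m*n {a} {b} (s≤s (s≤s z≤n)) (s≤s (s≤s z≤n))) ⟩
  (a * b) ^ 3     ≡⟨ solve 2 (λ a b → (a :* b) :^ 3 := a :^ 3 :* b :^ 3) refl a b ⟩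
  a ^ 3 * b ^ 3   ≤⟨ *-mono-≤ a³≤ b³≤ ⟩
  3 ^ x * 3 ^ y   ≡⟨ ^-distribˡ-+-* 3 x y ⟨
  3 ^ (x + y)     ∎
  where open ≤-Reasoning

3[a+b]≤2ab : ∀ {a b} → 2 ≤ a → 2 ≤ b → 8 ≤ a + b → 3 * (a + b) ≤ 2 * (a * b)
3[a+b]≤2ab {2} {b} _ _ 8≤2+b = subst₂ _≤_
  (solve 1 (λ b → con 6 :+ con 3 :* b := con 3 :* (con 2 :+ b)) refl b)
  (solve 1 (λ b → b :+ con 3 :* b := con 2 :* (con 2 :* b)) refl b)
  (+-monoˡ-≤ (3 * b) (+-cancelˡ-≤ 2 6 b 8≤2+b))
3[a+b]≤2ab {1} (s≤s ()) _ _
3[a+b]≤2ab {a@(suc (suc (suc _)))} {2} 2≤a 2≤2 8≤a+2 =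
  subst₂ _≤_ (cong (3 *_) (+-comm 2 a)) (cong (2 *_) (*-comm 2 a))
    (3[a+b]≤2ab {2} {a} 2≤2 2≤a (subst (8 ≤_) (+-comm a 2) 8≤a+2))
3[a+b]≤2ab {suc (suc (suc _))} {1} _ (s≤s ()) _
3[a+b]≤2ab {suc (suc (suc s))} {suc (suc (suc t))} _ _ _ = ≤-trans (m≤m+n _ (3 * s + 3 * t + 2 * (s * t)))
  (≤-reflexive (solve 2 (λ s t → con 3 :* (con 3 :+ s :+ (con 3 :+ t)) :+ (con 3 :* s :+ con 3 :* t :+ con 2 :* (s :* t))
                              := con 2 :* ((con 3 :+ s) :* (con 3 :+ t))) refl s t))

¬lowCost-+ : ∀ {a b x y} → 2 ≤ a → 2 ≤ b → 8 ≤ a + b → a ^ 3 ≤ 3 ^ x → b ^ 3 ≤ 3 ^ y →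
  ¬ LowCost (a + b) (x + y)
¬lowCost-+ {a} {b} {x} {y} 2≤a 2≤b 8≤a+b a³≤ b³≤ (lowCost p) = <⇒≱ p (begin
  3 * (a + b) ^ 3     ≤⟨ *-cancelˡ-≤ 9 (begin
      9 * (3 * (a + b) ^ 3) ≡⟨ solve 1 (λ s → con 9 :* (con 3 :* s :^ 3) := (con 3 :* s) :^ 3) refl (a + b) ⟩
      (3 * (a + b)) ^ 3     ≤⟨ ^-monoˡ-≤ 3 (3[a+b]≤2ab 2≤a 2≤b 8≤a+b) ⟩
      (2 * (a * b)) ^ 3     ≡⟨ solve 1 (λ p → (con 2 :* p) :^ 3 := con 8 :* p :^ 3) refl (a * b) ⟩
      8 * (a * b) ^ 3       ≤⟨ *-monoˡ-≤ ((a * b) ^ 3) (n≤1+n 8) ⟩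
      9 * (a * b) ^ 3       ∎) ⟩
  (a * b) ^ 3         ≡⟨ solve 2 (λ a b → (a :* b) :^ 3 := a :^ 3 :* b :^ 3) refl a b ⟩
  a ^ 3 * b ^ 3       ≤⟨ *-mono-≤ a³≤ b³≤ ⟩
  3 ^ x * 3 ^ y       ≡⟨ ^-distribˡ-+-* 3 x y ⟨
  3 ^ (x + y)         ∎)
  where open ≤-Reasoning

eval-positive : ∀ e → 1 ≤ eval e
eval-positive one     = s≤s z≤n
eval-positive (e ⊕ f) = ≤-trans (eval-positive e) (m≤m+n _ _)
eval-positive (e ⊗ f) = *-mono-≤ (eval-positive e) (eval-positive f)

ones-positive : ∀ e → 1 ≤ ones e
ones-positive one     = s≤s z≤n
ones-positive (e ⊕ f) = ≤-trans (ones-positive e) (m≤m+n _ _)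
ones-positive (e ⊗ f) = ≤-trans (ones-positive e) (m≤m+n _ _)

cube-eval≤3^ones : ∀ e → eval e ^ 3 ≤ 3 ^ ones e
cube-eval≤3^ones one     = s≤s z≤n
cube-eval≤3^ones (e ⊕ f) =
  cube-+-≤ (eval e) (eval f) (ones-positive e) (ones-positive f) (cube-eval≤3^ones e) (cube-eval≤3^ones f)
cube-eval≤3^ones (e ⊗ f) = begin
  (eval e * eval f) ^ 3     ≡⟨ solve 2 (λ a b → (a :* b) :^ 3 := a :^ 3 :* b :^ 3) refl (eval e) (eval f) ⟩
  eval e ^ 3 * eval f ^ 3   ≤⟨ *-mono-≤ (cube-eval≤3^ones e) (cube-eval≤3^ones f) ⟩
  3 ^ ones e * 3 ^ ones f   ≡⟨ ^-distribˡ-+-* 3 (ones e) (ones f) ⟨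
  3 ^ (ones e + ones f)     ∎
  where open ≤-Reasoning

lowCost⇒≤ones : ∀ {n c} e → LowCost n c → eval e ≡ n → c ≤ ones e
lowCost⇒≤ones {c = c} e (lowCost p) refl = ≮⇒≥ λ ones<c → <⇒≱ p (begin
  3 * eval e ^ 3    ≤⟨ *-monoʳ-≤ 3 (cube-eval≤3^ones e) ⟩
  3 ^ suc (ones e)  ≤⟨ ^-monoʳ-≤ 3 ones<c ⟩
  3 ^ c             ∎)
  where open ≤-Reasoning

Optimal : Expr → Set
Optimal e = ∀ e′ → eval e′ ≡ eval e → ones e ≤ ones e′

optimal-⊕ˡ : ∀ e f → Optimal (e ⊕ f) → Optimal e
optimal-⊕ˡ e f opt e′ p = +-cancelʳ-≤ (ones f) (ones e) (ones e′) (opt (e′ ⊕ f) (cong (_+ eval f) p))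

optimal-⊕ʳ : ∀ e f → Optimal (e ⊕ f) → Optimal f
optimal-⊕ʳ e f opt f′ p = +-cancelˡ-≤ (ones e) (ones f) (ones f′) (opt (e ⊕ f′) (cong (eval e +_) p))

optimal-⊗ˡ : ∀ e f → Optimal (e ⊗ f) → Optimal e
optimal-⊗ˡ e f opt e′ p = +-cancelʳ-≤ (ones f) (ones e) (ones e′) (opt (e′ ⊗ f) (cong (_* eval f) p))

optimal-⊗ʳ : ∀ e f → Optimal (e ⊗ f) → Optimal f
optimal-⊗ʳ e f opt f′ p = +-cancelˡ-≤ (ones e) (ones f) (ones f′) (opt (e ⊗ f′) (cong (eval e *_) p))

optimal⇒isComplexity : ∀ e → Optimal e → IsComplexity (eval e) (ones e)
optimal⇒isComplexity e opt = (e , refl , refl) , opt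

isComplexity-unique : ∀ {n c c′} → IsComplexity n c → IsComplexity n c′ → c ≡ c′
isComplexity-unique ((e , e≡ , refl) , least) ((e′ , e′≡ , refl) , least′) =
  ≤-antisym (least e′ e′≡) (least′ e e≡)

lowCost⇒isComplexity : ∀ {n c} e → eval e ≡ n → ones e ≡ c → LowCost n c → IsComplexity n c
lowCost⇒isComplexity e e≡ refl low = (e , e≡ , refl) , λ e′ e′≡ → lowCost⇒≤ones e′ low e′≡

two three : Expr
two   = one ⊕ one
three = two ⊕ one

_⊗[_]^_ : Expr → Expr → ℕ → Expr
e ⊗[ f ]^ zero  = e
e ⊗[ f ]^ suc k = (e ⊗[ f ]^ k) ⊗ f

eval-⊗^ : ∀ e f k → eval (e ⊗[ f ]^ k) ≡ eval e * eval f ^ k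
eval-⊗^ e f zero    = sym (*-identityʳ (eval e))
eval-⊗^ e f (suc k) = trans (cong (_* eval f) (eval-⊗^ e f k))
  (solve 3 (λ a b t → a :* t :* b := a :* (b :* t)) refl (eval e) (eval f) (eval f ^ k))

ones-⊗^ : ∀ e f k → ones (e ⊗[ f ]^ k) ≡ ones e + ones f * k
ones-⊗^ e f zero    = sym (trans (cong (ones e +_) (*-zeroʳ (ones f))) (+-identityʳ (ones e)))
ones-⊗^ e f (suc k) = trans (cong (_+ ones f) (ones-⊗^ e f k))
  (solve 3 (λ a b k → a :+ b :* k :+ b := a :+ b :* (con 1 :+ k)) refl (ones e) (ones f) k)

data FiniteCore : Set where
  2^[1+_] : Fin 9 → FiniteCore
  5·2^_   : Fin 4 → FiniteCore
  7·2^_   : Fin 3 → FiniteCore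
  ⟨19⟩ ⟨13⟩ : FiniteCore

-- The numbers of defect < 1 are exactly value d * 3 ^ k, of complexity cost d + 3 * k.  The
-- family 3^m + 1 starts at m = 4 because 3 + 1, 3² + 1 and 3³ + 1 are the finite cores 4, 10, 28.
data Core : Set where
  ⟨3⟩       : Core
  finite    : FiniteCore → Core
  3^[4+_]+1 : ℕ → Core

value : Core → ℕ
value ⟨3⟩                  = 3
value (finite 2^[1+ i ])   = 2 ^ (1 + toℕ i)
value (finite (5·2^ i))    = 5 * 2 ^ toℕ i
value (finite (7·2^ i))    = 7 * 2 ^ toℕ i
value (finite ⟨19⟩)        = 19
value (finite ⟨13⟩)        = 13
value (3^[4+ m ]+1)        = 3 ^ (4 + m) + 1

cost : Core → ℕ
cost ⟨3⟩                  = 3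
cost (finite 2^[1+ i ])   = 2 * (1 + toℕ i)
cost (finite (5·2^ i))    = 5 + 2 * toℕ i
cost (finite (7·2^ i))    = 6 + 2 * toℕ i
cost (finite ⟨19⟩)        = 9
cost (finite ⟨13⟩)        = 8
cost (3^[4+ m ]+1)        = 13 + 3 * m

coreExpr : Core → Expr
coreExpr ⟨3⟩                 = three
coreExpr (finite 2^[1+ i ])  = two ⊗[ two ]^ toℕ i
coreExpr (finite (5·2^ i))   = ((two ⊗ two) ⊕ one) ⊗[ two ]^ toℕ i
coreExpr (finite (7·2^ i))   = ((two ⊗ three) ⊕ one) ⊗[ two ]^ toℕ i
coreExpr (finite ⟨19⟩)       = (two ⊗ (three ⊗ three)) ⊕ one
coreExpr (finite ⟨13⟩)       = ((two ⊗ two) ⊗ three) ⊕ one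
coreExpr (3^[4+ m ]+1)       = (three ⊗[ three ]^ (3 + m)) ⊕ one

coreExpr-eval : ∀ d → eval (coreExpr d) ≡ value d
coreExpr-eval ⟨3⟩                = refl
coreExpr-eval (finite 2^[1+ i ]) = eval-⊗^ two two (toℕ i)
coreExpr-eval (finite (5·2^ i))  = eval-⊗^ ((two ⊗ two) ⊕ one) two (toℕ i)
coreExpr-eval (finite (7·2^ i))  = eval-⊗^ ((two ⊗ three) ⊕ one) two (toℕ i)
coreExpr-eval (finite ⟨19⟩)      = refl
coreExpr-eval (finite ⟨13⟩)      = refl
coreExpr-eval (3^[4+ m ]+1)      = cong (_+ 1) (eval-⊗^ three three (3 + m))

coreExpr-ones : ∀ d → ones (coreExpr d) ≡ cost d
coreExpr-ones ⟨3⟩                = refl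
coreExpr-ones (finite 2^[1+ i ]) = trans (ones-⊗^ two two (toℕ i)) (sym (*-suc 2 (toℕ i)))
coreExpr-ones (finite (5·2^ i))  = ones-⊗^ ((two ⊗ two) ⊕ one) two (toℕ i)
coreExpr-ones (finite (7·2^ i))  = ones-⊗^ ((two ⊗ three) ⊕ one) two (toℕ i)
coreExpr-ones (finite ⟨19⟩)      = refl
coreExpr-ones (finite ⟨13⟩)      = refl
coreExpr-ones (3^[4+ m ]+1)      = trans (cong (_+ 1) (ones-⊗^ three three (3 + m)))
  (solve 1 (λ m → con 3 :+ con 3 :* (con 3 :+ m) :+ con 1 := con 13 :+ con 3 :* m) refl m)

allFinite? : ∀ {P : FiniteCore → Set} → Decidable P → Dec (∀ c → P c)
allFinite? {P} P? = map′ to from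
  (all? (P? ∘ 2^[1+_]) ×-dec all? (P? ∘ 5·2^_) ×-dec all? (P? ∘ 7·2^_) ×-dec P? ⟨19⟩ ×-dec P? ⟨13⟩)
  where
  Cases : Set
  Cases = (∀ i → P 2^[1+ i ]) × (∀ i → P (5·2^ i)) × (∀ i → P (7·2^ i)) × P ⟨19⟩ × P ⟨13⟩
  to : Cases → ∀ c → P c
  to (p , _ , _ , _ , _) 2^[1+ i ] = p i
  to (_ , p , _ , _ , _) (5·2^ i)  = p i
  to (_ , _ , p , _ , _) (7·2^ i)  = p i
  to (_ , _ , _ , p , _) ⟨19⟩      = p
  to (_ , _ , _ , _ , p) ⟨13⟩      = p
  from : (∀ c → P c) → Cases
  from h = h ∘ 2^[1+_] , h ∘ 5·2^_ , h ∘ 7·2^_ , h ⟨19⟩ , h ⟨13⟩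

anyFinite? : ∀ {P : FiniteCore → Set} → Decidable P → Dec (∃[ c ] P c)
anyFinite? {P} P? = map′ to from
  (any? (P? ∘ 2^[1+_]) ⊎-dec any? (P? ∘ 5·2^_) ⊎-dec any? (P? ∘ 7·2^_) ⊎-dec P? ⟨19⟩ ⊎-dec P? ⟨13⟩)
  where
  Cases : Set
  Cases = (∃[ i ] P 2^[1+ i ]) ⊎ (∃[ i ] P (5·2^ i)) ⊎ (∃[ i ] P (7·2^ i)) ⊎ P ⟨19⟩ ⊎ P ⟨13⟩
  to : Cases → ∃[ c ] P c
  to (inj₁ (i , p))                 = 2^[1+ i ] , p
  to (inj₂ (inj₁ (i , p)))          = 5·2^ i , p
  to (inj₂ (inj₂ (inj₁ (i , p))))   = 7·2^ i , p
  to (inj₂ (inj₂ (inj₂ (inj₁ p))))  = ⟨19⟩ , p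
  to (inj₂ (inj₂ (inj₂ (inj₂ p))))  = ⟨13⟩ , p
  from : ∃[ c ] P c → Cases
  from (2^[1+ i ] , p) = inj₁ (i , p)
  from (5·2^ i , p)    = inj₂ (inj₁ (i , p))
  from (7·2^ i , p)    = inj₂ (inj₂ (inj₁ (i , p)))
  from (⟨19⟩ , p)      = inj₂ (inj₂ (inj₂ (inj₁ p)))
  from (⟨13⟩ , p)      = inj₂ (inj₂ (inj₂ (inj₂ p)))

CoreMultiple : ℕ → Set
CoreMultiple n = Σ Core λ d → ∃[ k ] n ≡ value d * 3 ^ k

CoreForm : ℕ → ℕ → Set
CoreForm n c = Σ Core λ d → ∃[ k ] n ≡ value d * 3 ^ k × c ≡ cost d + 3 * k

coreMultiple-*3^ : ∀ {n} j → CoreMultiple n → CoreMultiple (n * 3 ^ j)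
coreMultiple-*3^ j (d , k , refl) =
  d , k + j , trans (*-assoc (value d) (3 ^ k) (3 ^ j)) (cong (value d *_) (sym (^-distribˡ-+-* 3 k j)))

-- 3 is needed as the successor of the core 2.
SmallMultiple : ℕ → Set
SmallMultiple n = n ≡ 3 ⊎ ∃[ c ] Σ (Fin 2) λ j → n ≡ value (finite c) * 3 ^ toℕ j

smallMultiple? : ∀ n → Dec (SmallMultiple n)
smallMultiple? n = n ≟ 3 ⊎-dec anyFinite? λ c → any? λ j → n ≟ value (finite c) * 3 ^ toℕ j

Resolved : ℕ → ℕ → Set
Resolved n c = ¬ LowCost n c ⊎ SmallMultiple n

resolved? : ∀ n c → Dec (Resolved n c)
resolved? n c = ¬? (lowCost? n c) ⊎-dec smallMultiple? n

resolved⇒coreMultiple : ∀ {n c} → Resolved n c → LowCost n c → CoreMultiple n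
resolved⇒coreMultiple (inj₁ ¬low)               low = ⊥-elim (¬low low)
resolved⇒coreMultiple (inj₂ (inj₁ refl))        _   = ⟨3⟩ , 0 , refl
resolved⇒coreMultiple (inj₂ (inj₂ (c , j , n≡))) _  = finite c , toℕ j , n≡

finite-lowCost : ∀ c → LowCost (value (finite c)) (cost (finite c))
finite-lowCost = from-yes (allFinite? λ c → lowCost? (value (finite c)) (cost (finite c)))

finite-products-resolved : ∀ c c′ →
  Resolved (value (finite c) * value (finite c′)) (cost (finite c) + cost (finite c′))
finite-products-resolved = from-yes (allFinite? λ c → allFinite? λ c′ →
  resolved? (value (finite c) * value (finite c′)) (cost (finite c) + cost (finite c′)))

finite-successors-resolved : ∀ c (k : Fin 3) →
  Resolved (value (finite c) * 3 ^ toℕ k + 1) (cost (finite c) + 3 * toℕ k + 1)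
finite-successors-resolved = from-yes (allFinite? λ c → all? λ (k : Fin 3) →
  resolved? (value (finite c) * 3 ^ toℕ k + 1) (cost (finite c) + 3 * toℕ k + 1))

¬lowCost-finite*27+1 : ∀ c → ¬ LowCost (value (finite c) * 3 ^ 3 + 1) (cost (finite c) + 3 * 3 + 1)
¬lowCost-finite*27+1 = from-yes (allFinite? λ c →
  ¬? (lowCost? (value (finite c) * 3 ^ 3 + 1) (cost (finite c) + 3 * 3 + 1)))

¬lowCost-82*finite : ∀ c → ¬ LowCost (82 * value (finite c)) (13 + cost (finite c))
¬lowCost-82*finite = from-yes (allFinite? λ c → ¬? (lowCost? (82 * value (finite c)) (13 + cost (finite c))))

¬lowCost-82*82 : ¬ LowCost (82 * 82) (13 + 13)
¬lowCost-82*82 = from-no (lowCost? (82 * 82) (13 + 13))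

¬lowCost-83 : ¬ LowCost 83 14
¬lowCost-83 = from-no (lowCost? 83 14)

core-lowCost : ∀ d → LowCost (value d) (cost d)
core-lowCost ⟨3⟩           = from-yes (lowCost? 3 3)
core-lowCost (finite c)    = finite-lowCost c
core-lowCost (3^[4+ m ]+1) = lowCost (subst (_< 3 * value (3^[4+ m ]+1) ^ 3) 3[3^[4+m]]³≡
  (*-monoʳ-< 3 (^-monoˡ-< 3 (m<m+n (3 ^ (4 + m)) (s≤s z≤n)))))
  where
  3[3^[4+m]]³≡ : 3 * (3 ^ (4 + m)) ^ 3 ≡ 3 ^ (13 + 3 * m)
  3[3^[4+m]]³≡ = trans (cong (3 *_) (cube-3^ (4 + m))) (cong (λ t → 3 ^ (1 + t)) (*-distribˡ-+ 3 4 m))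

core-complexity : ∀ d k → IsComplexity (value d * 3 ^ k) (cost d + 3 * k)
core-complexity d k = lowCost⇒isComplexity (coreExpr d ⊗[ three ]^ k)
  (trans (eval-⊗^ (coreExpr d) three k) (cong (_* 3 ^ k) (coreExpr-eval d)))
  (trans (ones-⊗^ (coreExpr d) three k) (cong (_+ 3 * k) (coreExpr-ones d)))
  (lowCost-*3^ {value d} {cost d} k (core-lowCost d))

lowCost-3^[4+m]+1* : ∀ m n c →
  LowCost (value (3^[4+ m ]+1) * n) (cost (3^[4+ m ]+1) + c) → LowCost (82 * n) (13 + c)
lowCost-3^[4+m]+1* m n c low = lowCost-≤*3^ (82 * n) (13 + c) m value≤
  (subst (LowCost (value (3^[4+ m ]+1) * n)) (cong (13 +_) (+-comm (3 * m) c)) low)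
  where
  open ≤-Reasoning
  value≤ : value (3^[4+ m ]+1) * n ≤ 82 * n * 3 ^ m
  value≤ = begin
    (3 ^ (4 + m) + 1) * n    ≡⟨ cong (λ t → (t + 1) * n) (^-distribˡ-+-* 3 4 m) ⟩
    (81 * 3 ^ m + 1) * n     ≤⟨ *-monoˡ-≤ n (m*o+n≤[m+n]*o 81 1 (m^n>0 3 m)) ⟩
    82 * 3 ^ m * n           ≡⟨ solve 2 (λ t n → con 82 :* t :* n := con 82 :* n :* t) refl (3 ^ m) n ⟩
    82 * n * 3 ^ m           ∎

lowCost-successor-/3^ : ∀ n c k d →
  LowCost (n * 3 ^ (k + d) + 1) (c + 3 * (k + d) + 1) → LowCost (n * 3 ^ k + 1) (c + 3 * k + 1)
lowCost-successor-/3^ n c k d low =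
  lowCost-≤*3^ (n * 3 ^ k + 1) (c + 3 * k + 1) d value≤ (subst (LowCost (n * 3 ^ (k + d) + 1)) cost≡ low)
  where
  open ≤-Reasoning
  value≤ : n * 3 ^ (k + d) + 1 ≤ (n * 3 ^ k + 1) * 3 ^ d
  value≤ = begin
    n * 3 ^ (k + d) + 1       ≡⟨ cong (_+ 1) (trans (cong (n *_) (^-distribˡ-+-* 3 k d)) (sym (*-assoc n _ _))) ⟩
    n * 3 ^ k * 3 ^ d + 1     ≤⟨ m*o+n≤[m+n]*o (n * 3 ^ k) 1 (m^n>0 3 d) ⟩
    (n * 3 ^ k + 1) * 3 ^ d   ∎
  cost≡ : c + 3 * (k + d) + 1 ≡ c + 3 * k + 1 + 3 * d
  cost≡ = solve 3 (λ c k d → c :+ con 3 :* (k :+ d) :+ con 1 := c :+ con 3 :* k :+ con 1 :+ con 3 :* d) refl c k d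

lowCost-3^[4+m]+2 : ∀ m → LowCost (value (3^[4+ m ]+1) * 3 ^ 0 + 1) (cost (3^[4+ m ]+1) + 3 * 0 + 1) → LowCost 83 14
lowCost-3^[4+m]+2 m low =
  lowCost-≤*3^ 83 14 m value≤ (subst (LowCost (value (3^[4+ m ]+1) * 3 ^ 0 + 1)) cost≡ low)
  where
  open ≤-Reasoning
  value≤ : value (3^[4+ m ]+1) * 3 ^ 0 + 1 ≤ 83 * 3 ^ m
  value≤ = begin
    (3 ^ (4 + m) + 1) * 1 + 1   ≡⟨ cong (λ t → (t + 1) * 1 + 1) (^-distribˡ-+-* 3 4 m) ⟩
    (81 * 3 ^ m + 1) * 1 + 1    ≡⟨ cong (_+ 1) (*-identityʳ (81 * 3 ^ m + 1)) ⟩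
    81 * 3 ^ m + 1 + 1          ≡⟨ +-assoc (81 * 3 ^ m) 1 1 ⟩
    81 * 3 ^ m + 2              ≤⟨ m*o+n≤[m+n]*o 81 2 (m^n>0 3 m) ⟩
    83 * 3 ^ m                  ∎
  cost≡ : 13 + 3 * m + 3 * 0 + 1 ≡ 14 + 3 * m
  cost≡ = solve 1 (λ m → con 13 :+ con 3 :* m :+ con 3 :* con 0 :+ con 1 := con 14 :+ con 3 :* m) refl m

core-product : ∀ d d′ → LowCost (value d * value d′) (cost d + cost d′) → CoreMultiple (value d * value d′)
core-product ⟨3⟩ d′ _ = d′ , 1 , *-comm 3 (value d′)
core-product d ⟨3⟩ _ = d , 1 , refl
core-product (finite c) (finite c′) low = resolved⇒coreMultiple (finite-products-resolved c c′) low
core-product (3^[4+ m ]+1) (finite c) low =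
  ⊥-elim (¬lowCost-82*finite c (lowCost-3^[4+m]+1* m (value (finite c)) (cost (finite c)) low))
core-product (finite c) d@(3^[4+ m ]+1) low =
  ⊥-elim (¬lowCost-82*finite c (lowCost-3^[4+m]+1* m (value (finite c)) (cost (finite c))
    (lowCost-*-comm (value (finite c)) (value d) (cost (finite c)) (cost d) low)))
core-product (3^[4+ m ]+1) d′@(3^[4+ m′ ]+1) low =
  ⊥-elim (¬lowCost-82*82 (lowCost-3^[4+m]+1* m′ 82 13
    (lowCost-*-comm 82 (value d′) 13 (cost d′) (lowCost-3^[4+m]+1* m (value d′) (cost d′) low))))

core-successor : ∀ d k → LowCost (value d * 3 ^ k + 1) (cost d + 3 * k + 1) → CoreMultiple (value d * 3 ^ k + 1)
core-successor ⟨3⟩ 0 _ = finite 2^[1+ # 1 ] , 0 , refl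
core-successor ⟨3⟩ 1 _ = finite (5·2^ (# 1)) , 0 , refl
core-successor ⟨3⟩ 2 _ = finite (7·2^ (# 2)) , 0 , refl
core-successor ⟨3⟩ (suc (suc (suc d))) _ = 3^[4+ d ]+1 , 0 , sym (*-identityʳ _)
core-successor (finite c) 0 low = resolved⇒coreMultiple (finite-successors-resolved c (# 0)) low
core-successor (finite c) 1 low = resolved⇒coreMultiple (finite-successors-resolved c (# 1)) low
core-successor (finite c) 2 low = resolved⇒coreMultiple (finite-successors-resolved c (# 2)) low
core-successor (finite c) (suc (suc (suc d))) low =
  ⊥-elim (¬lowCost-finite*27+1 c (lowCost-successor-/3^ (value (finite c)) (cost (finite c)) 3 d low))
core-successor d@(3^[4+ m ]+1) k low =
  ⊥-elim (¬lowCost-83 (lowCost-3^[4+m]+2 m (lowCost-successor-/3^ (value d) (cost d) 0 k low)))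

small-coreMultiple : ∀ {n} → 2 ≤ n → n ≤ 7 → CoreMultiple n
small-coreMultiple {1} (s≤s ()) _
small-coreMultiple {2} _ _ = finite 2^[1+ # 0 ] , 0 , refl
small-coreMultiple {3} _ _ = ⟨3⟩ , 0 , refl
small-coreMultiple {4} _ _ = finite 2^[1+ # 1 ] , 0 , refl
small-coreMultiple {5} _ _ = finite (5·2^ (# 0)) , 0 , refl
small-coreMultiple {6} _ _ = finite 2^[1+ # 0 ] , 1 , refl
small-coreMultiple {7} _ _ = finite (7·2^ (# 0)) , 0 , refl
small-coreMultiple {suc (suc (suc (suc (suc (suc (suc (suc n)))))))} _ n≤7 = ⊥-elim (m+1+n≰m 7 n≤7)

optimal⇒coreForm : ∀ e → Optimal e → CoreMultiple (eval e) → CoreForm (eval e) (ones e)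
optimal⇒coreForm e opt (d , k , e≡) = d , k , e≡ ,
  isComplexity-unique (optimal⇒isComplexity e opt) (subst (λ n → IsComplexity n _) (sym e≡) (core-complexity d k))

coreForm-* : ∀ {a b x y} → CoreForm a x → CoreForm b y → LowCost (a * b) (x + y) → CoreMultiple (a * b)
coreForm-* (d , k , refl , refl) (d′ , k′ , refl , refl) low = subst CoreMultiple (sym value≡)
  (coreMultiple-*3^ (k + k′) (core-product d d′ (lowCost-/3^ (k + k′) (subst₂ LowCost value≡ cost≡ low))))
  where
  value≡ : value d * 3 ^ k * (value d′ * 3 ^ k′) ≡ value d * value d′ * 3 ^ (k + k′)
  value≡ = trans
    (solve 4 (λ v v′ t t′ → v :* t :* (v′ :* t′) := v :* v′ :* (t :* t′)) refl (value d) (value d′) (3 ^ k) (3 ^ k′))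
    (cong (value d * value d′ *_) (sym (^-distribˡ-+-* 3 k k′)))
  cost≡ : cost d + 3 * k + (cost d′ + 3 * k′) ≡ cost d + cost d′ + 3 * (k + k′)
  cost≡ = solve 4 (λ c c′ k k′ → c :+ con 3 :* k :+ (c′ :+ con 3 :* k′) := c :+ c′ :+ con 3 :* (k :+ k′))
    refl (cost d) (cost d′) k k′

coreForm-successor : ∀ {a x} → CoreForm a x → LowCost (a + 1) (x + 1) → CoreMultiple (a + 1)
coreForm-successor (d , k , refl , refl) = core-successor d k

Classifies : Expr → Set
Classifies e = LowCost (eval e) (ones e) → CoreForm (eval e) (ones e)

product-coreMultiple : ∀ e f → Classifies e → Classifies f →
  LowCost (eval e * eval f) (ones e + ones f) → CoreMultiple (eval e * eval f)
product-coreMultiple e f classifies-e classifies-f low = coreForm-*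
  (classifies-e (lowCost-*ˡ low (cube-eval≤3^ones f)))
  (classifies-f (lowCost-*ˡ (lowCost-*-comm (eval e) (eval f) (ones e) (ones f) low) (cube-eval≤3^ones e)))
  low

successor-coreMultiple : ∀ e f → eval f ≡ 1 → 7 < eval e + eval f → Classifies e →
  LowCost (eval e + eval f) (ones e + ones f) → CoreMultiple (eval e + eval f)
successor-coreMultiple e f f≡1 7<e+f classifies-e low rewrite f≡1 =
  coreForm-successor (classifies-e (lowCost-suc⁻¹ 3≤e low″)) low′
  where
  3≤e : 3 ≤ eval e
  3≤e = ≤-trans (s≤s (s≤s (s≤s z≤n))) (+-cancelʳ-≤ 1 7 (eval e) 7<e+f)
  low′ : LowCost (eval e + 1) (ones e + 1)
  low′ = lowCost-antimono low (+-monoʳ-≤ (ones e) (ones-positive f))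
  low″ : LowCost (suc (eval e)) (suc (ones e))
  low″ = subst₂ LowCost (+-comm (eval e) 1) (+-comm (ones e) 1) low′

sum-coreMultiple : ∀ e f → Classifies e → Classifies f →
  LowCost (eval e + eval f) (ones e + ones f) → CoreMultiple (eval e + eval f)
sum-coreMultiple e f classifies-e classifies-f low with eval e + eval f ≤? 7 | eval f ≟ 1 | eval e ≟ 1
... | yes ≤7 | _       | _       = small-coreMultiple (+-mono-≤ (eval-positive e) (eval-positive f)) ≤7
... | no ≰7  | yes f≡1 | _       = successor-coreMultiple e f f≡1 (≰⇒> ≰7) classifies-e low
... | no ≰7  | no _    | yes e≡1 = subst CoreMultiple (+-comm (eval f) (eval e))
  (successor-coreMultiple f e e≡1 (subst (7 <_) (+-comm (eval e) (eval f)) (≰⇒> ≰7)) classifies-f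
    (subst₂ LowCost (+-comm (eval e) (eval f)) (+-comm (ones e) (ones f)) low))
... | no ≰7  | no f≢1  | no e≢1  = ⊥-elim (¬lowCost-+ {eval e} {eval f} {ones e} {ones f}
  (≤∧≢⇒< (eval-positive e) (e≢1 ∘ sym)) (≤∧≢⇒< (eval-positive f) (f≢1 ∘ sym)) (≰⇒> ≰7)
  (cube-eval≤3^ones e) (cube-eval≤3^ones f) low)

optimal⇒classifies : ∀ e → Optimal e → Classifies e
optimal⇒classifies one _ (lowCost 3<3) = ⊥-elim (<-irrefl refl 3<3)
optimal⇒classifies (e ⊗ f) opt = optimal⇒coreForm (e ⊗ f) opt ∘ product-coreMultiple e f
  (optimal⇒classifies e (optimal-⊗ˡ e f opt)) (optimal⇒classifies f (optimal-⊗ʳ e f opt))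
optimal⇒classifies (e ⊕ f) opt = optimal⇒coreForm (e ⊕ f) opt ∘ sum-coreMultiple e f
  (optimal⇒classifies e (optimal-⊕ˡ e f opt)) (optimal⇒classifies f (optimal-⊕ʳ e f opt))

formComplexity : ∀ {n} → LowForm n → ℕ
formComplexity (form1 k _ _)     = 3 * k
formComplexity (form2 a k _ _ _) = 2 * a + 3 * k
formComplexity (form3 a k _ _)   = 5 + 2 * a + 3 * k
formComplexity (form4 a k _ _)   = 6 + 2 * a + 3 * k
formComplexity (form5 k _)       = 9 + 3 * k
formComplexity (form6 k _)       = 8 + 3 * k
formComplexity (form7 m k _ _)   = 1 + 3 * m + 3 * k

toℕ-preimage : ∀ {a n} → a < n → Σ (Fin n) λ i → toℕ i ≡ a
toℕ-preimage a<n = fromℕ< a<n , toℕ-fromℕ< a<n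

lowForm⇒coreForm : ∀ {n} (f : LowForm n) → CoreForm n (formComplexity f)
lowForm⇒coreForm (form1 zero () _)
lowForm⇒coreForm (form1 (suc k) _ refl) = ⟨3⟩ , k , refl , *-suc 3 k
lowForm⇒coreForm (form2 zero zero _ a,k≢0 _) = ⊥-elim (a,k≢0 (refl , refl))
lowForm⇒coreForm (form2 zero (suc k) _ _ refl) = ⟨3⟩ , k , *-identityˡ _ , *-suc 3 k
lowForm⇒coreForm (form2 (suc a) k a<9 _ refl) with toℕ-preimage a<9
... | i , refl = finite 2^[1+ i ] , k , refl , refl
lowForm⇒coreForm (form3 a k a≤3 refl) with toℕ-preimage (s≤s a≤3)
... | i , refl = finite (5·2^ i) , k , refl , refl
lowForm⇒coreForm (form4 a k a≤2 refl) with toℕ-preimage (s≤s a≤2)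
... | i , refl = finite (7·2^ i) , k , refl , refl
lowForm⇒coreForm (form5 k refl) = finite ⟨19⟩ , k , refl , refl
lowForm⇒coreForm (form6 k refl) = finite ⟨13⟩ , k , refl , refl
lowForm⇒coreForm (form7 zero _ () _)
lowForm⇒coreForm (form7 1 k _ refl) = finite 2^[1+ # 1 ] , k , refl , refl
lowForm⇒coreForm (form7 2 k _ refl) = finite (5·2^ (# 1)) , k , refl , refl
lowForm⇒coreForm (form7 3 k _ refl) = finite (7·2^ (# 2)) , k , refl , refl
lowForm⇒coreForm (form7 (suc (suc (suc (suc m)))) k _ refl) =
  3^[4+ m ]+1 , k , refl , cong (λ t → 1 + t + 3 * k) (*-distribˡ-+ 3 4 m)

coreForm⇒lowForm : ∀ {n c} → CoreForm n c → LowForm n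
coreForm⇒lowForm (⟨3⟩ , k , refl , _)               = form1 (suc k) (s≤s z≤n) refl
coreForm⇒lowForm (finite 2^[1+ i ] , k , refl , _) = form2 (suc (toℕ i)) k (toℕ<n i) (λ { (() , _) }) refl
coreForm⇒lowForm (finite (5·2^ i) , k , refl , _)  = form3 (toℕ i) k (s≤s⁻¹ (toℕ<n i)) refl
coreForm⇒lowForm (finite (7·2^ i) , k , refl , _)  = form4 (toℕ i) k (s≤s⁻¹ (toℕ<n i)) refl
coreForm⇒lowForm (finite ⟨19⟩ , k , refl , _)      = form5 k refl
coreForm⇒lowForm (finite ⟨13⟩ , k , refl , _)      = form6 k refl
coreForm⇒lowForm (3^[4+ m ]+1 , k , refl , _)      = form7 (4 + m) k (s≤s z≤n) refl

lowForm-complexity : ∀ {n} (f : LowForm n) → IsComplexity n (formComplexity f)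
lowForm-complexity f with lowForm⇒coreForm f
... | d , k , n≡ , c≡ = subst₂ IsComplexity (sym n≡) (sym c≡) (core-complexity d k)

lowForm⇒lowCost : ∀ {n c} → IsComplexity n c → LowForm n → LowCost n c
lowForm⇒lowCost ic f with lowForm⇒coreForm f
... | d , k , n≡ , c≡ = subst₂ LowCost (sym n≡) (sym (trans (isComplexity-unique ic (lowForm-complexity f)) c≡))
  (lowCost-*3^ k (core-lowCost d))

defectLt1⇔lowForm : ∀ {n c} → IsComplexity n c → DefectLt1 n c ⇔ LowForm n
defectLt1⇔lowForm ic@((e , refl , refl) , optimal) = mk⇔
  (λ δ<1 → coreForm⇒lowForm (optimal⇒classifies e optimal (Equivalence.from lowCost⇔δ<1 δ<1)))
  (λ f → Equivalence.to lowCost⇔δ<1 (lowForm⇒lowCost ic f))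
  where
  lowCost⇔δ<1 : LowCost (eval e) (ones e) ⇔ DefectLt1 (eval e) (ones e)
  lowCost⇔δ<1 = lowCost⇔defectLt1 (ones-positive e)

prime∣^⇒∣ : ∀ {p} m k → Prime p → p ∣ m ^ k → p ∣ m
prime∣^⇒∣ m zero    pp p∣1 = ⊥-elim (¬prime[1] (subst Prime (∣1⇒≡1 p∣1) pp))
prime∣^⇒∣ m (suc k) pp p∣m^[1+k] with euclidsLemma m (m ^ k) pp p∣m^[1+k]
... | inj₁ p∣m   = p∣m
... | inj₂ p∣m^k = prime∣^⇒∣ m k pp p∣m^k

cube≡1⇒≡1 : ∀ {n} → n ^ 3 ≡ 1 → n ≡ 1
cube≡1⇒≡1 {1} _ = refl
cube≡1⇒≡1 {suc (suc n)} n³≡1 =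
  ⊥-elim (<⇒≱ (s≤s (s≤s z≤n)) (subst (8 ≤_) n³≡1 (^-monoˡ-≤ 3 {2} {suc (suc n)} (s≤s (s≤s z≤n)))))

9*≢ : ∀ x {y} → 0 < y → y < 9 → 9 * x ≢ y
9*≢ zero    0<y _   refl = <-irrefl refl 0<y
9*≢ (suc x) _   y<9 refl = <⇒≱ y<9 (m≤m*n 9 (suc x))

cube≡3^⇒≡3^ : ∀ n t → n ^ 3 ≡ 3 ^ t → ∃[ j ] n ≡ 3 ^ j
cube≡3^⇒≡3^ n zero n³≡1 = 0 , cube≡1⇒≡1 n³≡1
cube≡3^⇒≡3^ n (suc t) n³≡
  with prime∣^⇒∣ n 3 (from-yes (prime? 3)) (divides (3 ^ t) (trans n³≡ (*-comm 3 (3 ^ t))))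
... | divides q refl = Product.map suc (λ {j} q≡3^j → trans (cong (_* 3) q≡3^j) (*-comm (3 ^ j) 3))
  (9q³≡3^⇒≡3^ t (*-cancelˡ-≡ (9 * q ^ 3) (3 ^ t) 3 (trans 27q³≡ n³≡)))
  where
  27q³≡ : 3 * (9 * q ^ 3) ≡ (q * 3) ^ 3
  27q³≡ = solve 1 (λ q → con 3 :* (con 9 :* q :^ 3) := (q :* con 3) :^ 3) refl q
  9q³≡3^⇒≡3^ : ∀ t → 9 * q ^ 3 ≡ 3 ^ t → ∃[ j ] q ≡ 3 ^ j
  9q³≡3^⇒≡3^ 0 eq = ⊥-elim (9*≢ (q ^ 3) (s≤s z≤n) (s≤s (s≤s z≤n)) eq)
  9q³≡3^⇒≡3^ 1 eq = ⊥-elim (9*≢ (q ^ 3) (s≤s z≤n) (s≤s (s≤s (s≤s (s≤s z≤n)))) eq)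
  9q³≡3^⇒≡3^ (suc (suc s)) eq =
    cube≡3^⇒≡3^ q s (*-cancelˡ-≡ (q ^ 3) (3 ^ s) 9 (trans eq (sym (*-assoc 3 3 (3 ^ s)))))

isComplexity-1 : IsComplexity 1 1
isComplexity-1 = (one , refl , refl) , λ e _ → ones-positive e

defectEq1⇒≡1 : ∀ {n c} → IsComplexity n c → DefectEq1 n c → n ≡ 1
defectEq1⇒≡1 {n} {c} ic δ≡1 with cube≡3^⇒≡3^ n (c ∸ 1) (sym δ≡1)
... | zero  , n≡1 = n≡1
... | suc j , refl = ⊥-elim (<-irrefl 3^[2+3j]≡3^[3+3j] (^-monoʳ-< 3 (s≤s (s≤s z≤n)) (n<1+n (2 + 3 * j))))
  where
  3^[2+3j]≡3^[3+3j] : 3 ^ (2 + 3 * j) ≡ 3 ^ (3 + 3 * j)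
  3^[2+3j]≡3^[3+3j] = begin
    3 ^ (2 + 3 * j)   ≡⟨ cong (λ c → 3 ^ (c ∸ 1)) (isComplexity-unique (core-complexity ⟨3⟩ j) ic) ⟩
    3 ^ (c ∸ 1)       ≡⟨ δ≡1 ⟩
    (3 ^ suc j) ^ 3   ≡⟨ cube-3^ (suc j) ⟩
    3 ^ (3 * suc j)   ≡⟨ cong (3 ^_) (*-suc 3 j) ⟩
    3 ^ (3 + 3 * j)   ∎
    where open ≡-Reasoning

defectEq1⇔≡1 : ∀ {n c} → IsComplexity n c → DefectEq1 n c ⇔ n ≡ 1
defectEq1⇔≡1 ic =
  mk⇔ (defectEq1⇒≡1 ic) λ { refl → cong (λ c → 3 ^ (c ∸ 1)) (isComplexity-unique ic isComplexity-1) }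

-- The hypotheses 1 ≤ n are unused: IsComplexity n c already implies them.
theorem1p6 :
    ((n c : ℕ) → 1 ≤ n → IsComplexity n c → (DefectLt1 n c ⇔ LowForm n))
    × ((k : ℕ) → 1 ≤ k → IsComplexity (3 ^ k) (3 * k))
    × ((a k : ℕ) → a ≤ 9 → ¬ (a ≡ 0 × k ≡ 0) → IsComplexity (2 ^ a * 3 ^ k) (2 * a + 3 * k))
    × ((a k : ℕ) → a ≤ 3 → IsComplexity (5 * 2 ^ a * 3 ^ k) (5 + 2 * a + 3 * k))
    × ((a k : ℕ) → a ≤ 2 → IsComplexity (7 * 2 ^ a * 3 ^ k) (6 + 2 * a + 3 * k))
    × ((k : ℕ) → IsComplexity (19 * 3 ^ k) (9 + 3 * k))
    × ((k : ℕ) → IsComplexity (13 * 3 ^ k) (8 + 3 * k))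
    × ((m k : ℕ) → 1 ≤ m → IsComplexity ((3 ^ m + 1) * 3 ^ k) (1 + 3 * m + 3 * k))
    × ((n c : ℕ) → 1 ≤ n → IsComplexity n c → (DefectEq1 n c ⇔ n ≡ 1))
theorem1p6 =
    (λ _ _ _ → defectLt1⇔lowForm)
  , (λ k 1≤k → lowForm-complexity (form1 k 1≤k refl))
  , (λ a k a≤9 a,k≢0 → lowForm-complexity (form2 a k a≤9 a,k≢0 refl))
  , (λ a k a≤3 → lowForm-complexity (form3 a k a≤3 refl))
  , (λ a k a≤2 → lowForm-complexity (form4 a k a≤2 refl))
  , (λ k → lowForm-complexity (form5 k refl))
  , (λ k → lowForm-complexity (form6 k refl))
  , (λ m k 1≤m → lowForm-complexity (form7 m k 1≤m refl))
  , (λ _ _ _ → defectEq1⇔≡1)
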